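{- Let $R$ be a commutative Frobenius ring with unity and with a fixed non-trivial involutory ring automorphism $x\mapsto\overline{x}$. Let $k,n\in\mathbb{N}$, $x_1,x_2,x_3\in R$, and $\mathbf{a}_i=(a_{i:0},\dots,a_{i:n-1})\in R^n$ for $i\in\{0,\dots,k-1\}$, with $A_i=\mathrm{circ}(\mathbf{a}_i)$. Let $X_2\in R^{kn}$ be the row vector all of whose entries equal $x_2$, and $X_3\in R^{kn}$ the row vector all of whose entries equal $x_3$. Let $$G=\begin{pmatrix} I_{kn+1} & X\end{pmatrix},\quad X=\begin{pmatrix} x_1 & X_2\\ X_3^T & Y\end{pmatrix},\quad Y=\mathrm{circ}(A_0,A_1,\dots,A_{k-1}).$$ Then $G$ is a generator matrix of a Hermitian self-dual $[2(kn+1),kn+1]$-code over $R$ if and only if all of the following hold: (i) $1+x_1\overline{x_1}+knx_2\overline{x_2}=0$; (ii) $x_1\overline{x_3}+x_2\sum_{i=0}^{k-1}\sum_{s=0}^{n-1}\overline{a_{i:s}}=0$; (iii) $\sum_{i=0}^{k-1}\Theta(\mathbf{a}_i,\overline{\mathbf{a}_i},t)=-1-x_3\overline{x_3}$ for $t=0$ and $=-x_3\overline{x_3}$ for $t\in\{1,\dots,\lfloor n/2\rfloor\}$; (iv) $\sum_{i=0}^{k-1}\Theta(\mathbf{a}_{[i+j]_k},\overline{\mathbf{a}_i},0)=-x_3\overline{x_3}$ for every $j\in\{1,\dots,\lfloor k/2\rfloor\}$; (v) $\sum_{i=0}^{k-1}\Theta(\mathbf{a}_{[i+j]_k},\overline{\mathbf{a}_i},t)=-x_3\overline{x_3}$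 for every $j\in\{1,\dots,k-1\}$ and $t\in\{1,\dots,\lfloor n/2\rfloor\}$.
   Context: For a vector or matrix over $R$, the bar denotes entrywise application of the involution. $\mathrm{circ}(\mathbf{v})$ for $\mathbf{v}\in R^n$ is the $n\times n$ circulant matrix whose first row is $\mathbf{v}$ and each subsequent row is the previous row shifted cyclically one place to the right; $\mathrm{circ}(A_0,\dots,A_{k-1})$ is the $kn\times kn$ block circulant matrix whose first block row is $(A_0,\dots,A_{k-1})$ and each subsequent block row is the previous one shifted cyclically one block to the right. $[m]_N\in\{0,\dots,N-1\}$ is the residue of $m$ modulo $N$. For $\mathbf{x}=(x_0,\dots,x_{n-1}),\mathbf{y}=(y_0,\dots,y_{n-1})\in R^n$ and $j\in\{0,\dots,n-1\}$: $\Theta(\mathbf{x},\mathbf{y},j)=\sum_{i=0}^{n-1}x_{[i+j]_n}y_i$. The Hermitian inner product on $R^N$ is $\langle\mathbf{x},\mathbf{y}\rangle_H=\sum_i x_i\overline{y_i}$; a code (the $R$-submodule generated by the rows of $G$) is Hermitian self-dual if it equals its Hermitian dual $\{\mathbf{x}:\langle\mathbf{x},\mathbf{y}\rangle_H=0\ \forall\mathbf{y}\in\mathcal{C}\}$. -}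

module Defs where

open import Level using (_⊔_) renaming (suc to lsuc)
open import Algebra.Bundles using (CommutativeRing)
open import Data.Nat as ℕ using (ℕ; zero; suc; NonZero)
open import Data.Nat.DivMod using (_mod_)
open import Data.Fin as Fin using (Fin; toℕ; splitAt; remQuot)
open import Data.Sum using (_⊎_; [_,_]′)
open import Data.Product using (Σ; _×_; _,_)
open import Relation.Nullary using (¬_)

module Over {c ℓ} (R : CommutativeRing c ℓ) where
  open CommutativeRing R

  open import Algebra.Definitions.RawMonoid +-rawMonoid public
    using (sum) renaming (_×_ to _·ℕ_)

  IsFinite : Set (c ⊔ ℓ)
  IsFinite = Σ ℕ λ m → Σ (Fin m → Carrier) λ f → ∀ x → Σ (Fin m) λ i → f i ≈ x

  Pred : Set (lsuc (c ⊔ ℓ))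
  Pred = Carrier → Set (c ⊔ ℓ)

  _⊆_ : Pred → Pred → Set (c ⊔ ℓ)
  I ⊆ J = ∀ {x} → I x → J x

  record IsIdeal (I : Pred) : Set (c ⊔ ℓ) where
    field
      ≈-resp   : ∀ {x y} → x ≈ y → I x → I y
      0∈       : I 0#
      +-closed : ∀ {x y} → I x → I y → I (x + y)
      -‿closed : ∀ {x} → I x → I (- x)
      *-closed : ∀ r {x} → I x → I (r * x)

  IsMaximalIdeal : Pred → Set (lsuc (c ⊔ ℓ))
  IsMaximalIdeal M =
    IsIdeal M × (¬ M 1#) ×
    (∀ (J : Pred) → IsIdeal J → M ⊆ J → (J ⊆ M) ⊎ J 1#)

  IsMinimalIdeal : Pred → Set (lsuc (c ⊔ ℓ))
  IsMinimalIdeal M =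
    IsIdeal M × (Σ Carrier λ x → M x × ¬ (x ≈ 0#)) ×
    (∀ (J : Pred) → IsIdeal J → J ⊆ M → (∀ {x} → J x → x ≈ 0#) ⊎ (M ⊆ J))

  Jac : Carrier → Set (lsuc (c ⊔ ℓ))
  Jac x = ∀ (M : Pred) → IsMaximalIdeal M → M x

  -- Socle: sum of all minimal ideals, i.e. the ideal generated by
  -- their union (= intersection of all ideals containing every minimal ideal)
  Soc : Carrier → Set (lsuc (c ⊔ ℓ))
  Soc x = ∀ (I : Pred) → IsIdeal I → (∀ (M : Pred) → IsMinimalIdeal M → M ⊆ I) → I x

  -- A finite commutative ring R is Frobenius iff R/J(R) ≅ soc(R) as
  -- R-modules.  An R-module isomorphism R/J → soc(R) is given by a map
  -- f : R → R with image in soc(R), constant on J-cosets, R-linear,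
  -- injective on R/J and onto soc(R).
  IsFrobenius : Set (lsuc (c ⊔ ℓ))
  IsFrobenius =
    IsFinite ×
    Σ (Carrier → Carrier) λ f →
      (∀ x → Soc (f x)) ×
      (∀ x y → Jac (x - y) → f x ≈ f y) ×
      (∀ x y → f (x + y) ≈ f x + f y) ×
      (∀ r x → f (r * x) ≈ r * f x) ×
      (∀ x y → f x ≈ f y → Jac (x - y)) ×
      (∀ s → Soc s → Σ Carrier λ x → f x ≈ s)

  record IsNontrivialInvolution (bar : Carrier → Carrier) : Set (c ⊔ ℓ) where
    field
      cong       : ∀ {x y} → x ≈ y → bar x ≈ bar y
      +-hom      : ∀ x y → bar (x + y) ≈ bar x + bar y
      *-hom      : ∀ x y → bar (x * y) ≈ bar x * bar y
      1-hom      : bar 1# ≈ 1#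
      involutive : ∀ x → bar (bar x) ≈ x
      nontrivial : Σ Carrier λ x → ¬ (bar x ≈ x)

  Mat : ℕ → ℕ → Set c
  Mat m n = Fin m → Fin n → Carrier

  idMat : ∀ {n} → Mat n n
  idMat Fin.zero    Fin.zero    = 1#
  idMat Fin.zero    (Fin.suc j) = 0#
  idMat (Fin.suc i) Fin.zero    = 0#
  idMat (Fin.suc i) (Fin.suc j) = idMat i j

  _∣∣_ : ∀ {m n n′} → Mat m n → Mat m n′ → Mat m (n ℕ.+ n′)
  _∣∣_ {n = n} A B i j = [ A i , B i ]′ (splitAt n j)

  -- circ(v): first row v, each row the previous one shifted cyclically
  -- one place to the right, so entry (u,w) is v_{[w-u]_n}
  circ : ∀ {n} .{{_ : NonZero n}} → (Fin n → Carrier) → Mat n n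
  circ {n} v u w = v ((toℕ w ℕ.+ (n ℕ.∸ toℕ u)) mod n)

  -- circ(A_0,…,A_{k-1}): block (p,q) is A_{[q-p]_k}; the index of
  -- Fin (k*n) is decomposed as p*n+u (block p, position u)
  blockCirc : ∀ {k n} .{{_ : NonZero k}} → (Fin k → Mat n n) → Mat (k ℕ.* n) (k ℕ.* n)
  blockCirc {k} {n} A r s with remQuot {k} n r | remQuot {k} n s
  ... | p , u | q , w = A ((toℕ q ℕ.+ (k ℕ.∸ toℕ p)) mod k) u w

  borderMat : ∀ {m} → Carrier → Carrier → Carrier → Mat m m → Mat (suc m) (suc m)
  borderMat x₁ x₂ x₃ Y Fin.zero    Fin.zero    = x₁
  borderMat x₁ x₂ x₃ Y Fin.zero    (Fin.suc j) = x₂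
  borderMat x₁ x₂ x₃ Y (Fin.suc i) Fin.zero    = x₃
  borderMat x₁ x₂ x₃ Y (Fin.suc i) (Fin.suc j) = Y i j

  genMatrix : ∀ (k n : ℕ) .{{_ : NonZero k}} .{{_ : NonZero n}} →
              Carrier → Carrier → Carrier → (Fin k → Fin n → Carrier) →
              Mat (suc (k ℕ.* n)) (suc (k ℕ.* n) ℕ.+ suc (k ℕ.* n))
  genMatrix k n x₁ x₂ x₃ a =
    idMat ∣∣ borderMat x₁ x₂ x₃ (blockCirc (λ i → circ (a i)))

  RowSpan : ∀ {m N} → Mat m N → (Fin N → Carrier) → Set (c ⊔ ℓ)
  RowSpan {m} G x = Σ (Fin m → Carrier) λ λs → ∀ j → x j ≈ sum (λ i → λs i * G i j)

  Θ : ∀ {n} .{{_ : NonZero n}} → (Fin n → Carrier) → (Fin n → Carrier) → ℕ → Carrier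
  Θ {n} x y j = sum (λ i → x ((toℕ i ℕ.+ j) mod n) * y i)

  module WithInvolution (bar : Carrier → Carrier) where

    ⟨_,_⟩H : ∀ {N} → (Fin N → Carrier) → (Fin N → Carrier) → Carrier
    ⟨ x , y ⟩H = sum (λ i → x i * bar (y i))

    HermitianDual : ∀ {N} → ((Fin N → Carrier) → Set (c ⊔ ℓ)) → (Fin N → Carrier) → Set (c ⊔ ℓ)
    HermitianDual C x = ∀ y → C y → ⟨ x , y ⟩H ≈ 0#

    IsHermitianSelfDual : ∀ {N} → ((Fin N → Carrier) → Set (c ⊔ ℓ)) → Set (c ⊔ ℓ)
    IsHermitianSelfDual C = ∀ x → (C x → HermitianDual C x) × (HermitianDual C x → C x)

-- G = (I | X) generates a Hermitian self-dual code iff X X̄ᵀ = -I and X̄ᵀ X = -I: the first says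
-- that the rows of G are orthogonal to each other, the second that a vector orthogonal to all rows
-- is the combination of the rows whose coefficients are its left half.  For the bordered matrix X
-- the second identity follows from the first, because Y = circ(A₀,…,A_{k-1}) commutes with Ȳᵀ and
-- has all row and column sums equal to S = Σ a, which leaves scalar identities on the border.
-- The border entries of X X̄ᵀ + I give (i) and (ii); an entry inside the Y-block depends only on the
-- cyclic shift (g, h) ∈ ℤ/k × ℤ/n between the block and position indices of row and column, and
-- equals δ + x₃x̄₃ + T(g, h) with the correlation T(g, h) = Σᵢ Θ(a_{i+g}, āᵢ, h).  As X X̄ᵀ is
-- Hermitian, the condition at (-g, -h) is the conjugate of that at (g, h), so the half range of
-- shifts in (iii)–(v) suffices.

module Submission where

open import Defs
open import Algebra.Bundles using (CommutativeRing; AbelianGroup)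
open import Algebra.Structures using (IsAbelianGroup)
open import Data.Nat as ℕ using (ℕ; NonZero; zero; suc; s≤s; z≤n; _≤_; _<_; _∸_; _%_; _≟_; _≤?_; ⌊_/2⌋; ⌈_/2⌉)
import Data.Nat.Properties as ℕₚ
open import Data.Nat.DivMod
open import Data.Fin as Fin using (Fin; toℕ; _↑ˡ_; _↑ʳ_; splitAt; combine; remQuot)
open import Data.Fin.Permutation using (Permutation′; permutation; _⟨$⟩ʳ_)
open import Data.Fin.Properties
  using (toℕ-injective; toℕ<n; toℕ-fromℕ<; splitAt-↑ˡ; splitAt-↑ʳ; join-splitAt;
         remQuot-combine; combine-remQuot; combine-injective)
  renaming (_≟_ to _≟ᶠ_)
open import Data.Product using (_×_; _,_; proj₁; proj₂; uncurry; swap)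
open import Data.Sum as Sum using (_⊎_; inj₁; inj₂; [_,_]′)
open import Function.Base using (_∘_)
open import Function.Bundles using (_⇔_; mk⇔; Equivalence)
open import Relation.Binary.PropositionalEquality as ≡ using (_≡_; module ≡-Reasoning)
open import Relation.Nullary using (¬_; yes; no; contradiction)

⌊m/2⌋<n⇒m∸n≤⌊m/2⌋ : ∀ m {n} → ⌊ m /2⌋ < n → m ∸ n ≤ ⌊ m /2⌋
⌊m/2⌋<n⇒m∸n≤⌊m/2⌋ m {n} lt = ℕₚ.m≤n+o⇒m∸n≤o m n (begin
  m                   ≡⟨ ≡.sym (ℕₚ.⌊n/2⌋+⌈n/2⌉≡n m) ⟩
  ⌊ m /2⌋ ℕ.+ ⌈ m /2⌉ ≤⟨ ℕₚ.+-monoʳ-≤ ⌊ m /2⌋ (ℕₚ.≤-trans (ℕₚ.⌊n/2⌋-mono (ℕₚ.n≤1+n (suc m))) lt) ⟩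
  ⌊ m /2⌋ ℕ.+ n       ≡⟨ ℕₚ.+-comm ⌊ m /2⌋ n ⟩
  n ℕ.+ ⌊ m /2⌋       ∎)
  where open ℕₚ.≤-Reasoning

↑ˡ-↑ʳ-elim : ∀ {m n p} {P : Fin (m ℕ.+ n) → Set p} →
             (∀ i → P (i ↑ˡ n)) → (∀ j → P (m ↑ʳ j)) → ∀ k → P k
↑ˡ-↑ʳ-elim {m} {n} {P = P} Pˡ Pʳ k = ≡.subst P (join-splitAt m n k) (P-join (splitAt m k))
  where
  P-join : ∀ s → P (Fin.join m n s)
  P-join (inj₁ i) = Pˡ i
  P-join (inj₂ j) = Pʳ j

combine-elim : ∀ {m n p} {P : Fin (m ℕ.* n) → Set p} → (∀ i j → P (combine i j)) → ∀ k → P k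
combine-elim {m} {n} {P = P} P-combine k =
  ≡.subst P (combine-remQuot {m} n k) (uncurry P-combine (remQuot {m} n k))

module Cyclic (m : ℕ) .{{_ : NonZero m}} where
  open ≡ using (refl; cong; cong₂; subst; trans; sym)
  open ℕₚ using (+-comm; +-assoc; +-identityʳ; ≤-trans; <⇒≤; n≤0⇒n≡0; 1+n≰n; ⌊n/2⌋<n; m<n⇒0<n∸m;
                 m+[n∸m]≡n; ∸-monoʳ-<; suc-pred; m≤pred[n]⇒suc[m]≤n; pred[m∸n]≡m∸[1+n])

  infixl 6 _⊕_ _+ₖ_ _-ₖ_
  infix  8 -ₖ_

  _⊕_ : Fin m → ℕ → Fin m
  i ⊕ c = (toℕ i ℕ.+ c) mod m

  _+ₖ_ : Fin m → Fin m → Fin m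
  i +ₖ j = i ⊕ toℕ j

  -ₖ_ : Fin m → Fin m
  -ₖ i = (m ∸ toℕ i) mod m

  0ₖ : Fin m
  0ₖ = 0 mod m

  _-ₖ_ : Fin m → Fin m → Fin m
  i -ₖ j = i +ₖ -ₖ j

  toℕ-mod : ∀ x → toℕ (x mod m) ≡ x % m
  toℕ-mod x = toℕ-fromℕ< (m%n<n x m)

  toℕ-mod-< : ∀ {x} → x < m → toℕ (x mod m) ≡ x
  toℕ-mod-< x<m = trans (toℕ-mod _) (m<n⇒m%n≡m x<m)

  toℕ-mod-toℕ : ∀ i → toℕ i mod m ≡ i
  toℕ-mod-toℕ i = toℕ-injective (toℕ-mod-< (toℕ<n i))

  toℕ-0ₖ : toℕ 0ₖ ≡ 0
  toℕ-0ₖ = trans (toℕ-mod 0) (n≤0⇒n≡0 (m%n≤m 0 m))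

  [x%m+y]%m≡[x+y]%m : ∀ x y → (x % m ℕ.+ y) % m ≡ (x ℕ.+ y) % m
  [x%m+y]%m≡[x+y]%m x y = begin
    (x % m ℕ.+ y) % m          ≡⟨ %-distribˡ-+ (x % m) y m ⟩
    (x % m % m ℕ.+ y % m) % m  ≡⟨ cong (λ z → (z ℕ.+ y % m) % m) (m%n%n≡m%n x m) ⟩
    (x % m ℕ.+ y % m) % m      ≡⟨ %-distribˡ-+ x y m ⟨
    (x ℕ.+ y) % m              ∎
    where open ≡-Reasoning

  [x+y%m]%m≡[x+y]%m : ∀ x y → (x ℕ.+ y % m) % m ≡ (x ℕ.+ y) % m
  [x+y%m]%m≡[x+y]%m x y = begin
    (x ℕ.+ y % m) % m  ≡⟨ cong (_% m) (+-comm x (y % m)) ⟩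
    (y % m ℕ.+ x) % m  ≡⟨ [x%m+y]%m≡[x+y]%m y x ⟩
    (y ℕ.+ x) % m      ≡⟨ cong (_% m) (+-comm y x) ⟩
    (x ℕ.+ y) % m      ∎
    where open ≡-Reasoning

  ⊕-mod : ∀ i c → i ⊕ c ≡ i +ₖ c mod m
  ⊕-mod i c = toℕ-injective (begin
    toℕ (i ⊕ c)                     ≡⟨ toℕ-mod _ ⟩
    (toℕ i ℕ.+ c) % m                ≡⟨ [x+y%m]%m≡[x+y]%m (toℕ i) c ⟨
    (toℕ i ℕ.+ c % m) % m            ≡⟨ cong (λ z → (toℕ i ℕ.+ z) % m) (toℕ-mod c) ⟨
    (toℕ i ℕ.+ toℕ (c mod m)) % m    ≡⟨ toℕ-mod _ ⟨
    toℕ (i +ₖ c mod m)               ∎)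
    where open ≡-Reasoning

  i⊕0≡i : ∀ i → i ⊕ 0 ≡ i
  i⊕0≡i i = trans (cong (_mod m) (+-identityʳ (toℕ i))) (toℕ-mod-toℕ i)

  +ₖ-comm : ∀ i j → i +ₖ j ≡ j +ₖ i
  +ₖ-comm i j = cong (_mod m) (+-comm (toℕ i) (toℕ j))

  +ₖ-assoc : ∀ i j l → (i +ₖ j) +ₖ l ≡ i +ₖ (j +ₖ l)
  +ₖ-assoc i j l = toℕ-injective (begin
    toℕ ((i +ₖ j) +ₖ l)                        ≡⟨ toℕ-mod _ ⟩
    (toℕ (i +ₖ j) ℕ.+ toℕ l) % m               ≡⟨ cong (λ z → (z ℕ.+ toℕ l) % m) (toℕ-mod _) ⟩
    ((toℕ i ℕ.+ toℕ j) % m ℕ.+ toℕ l) % m      ≡⟨ [x%m+y]%m≡[x+y]%m _ (toℕ l) ⟩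
    (toℕ i ℕ.+ toℕ j ℕ.+ toℕ l) % m            ≡⟨ cong (_% m) (+-assoc (toℕ i) (toℕ j) (toℕ l)) ⟩
    (toℕ i ℕ.+ (toℕ j ℕ.+ toℕ l)) % m          ≡⟨ [x+y%m]%m≡[x+y]%m (toℕ i) _ ⟨
    (toℕ i ℕ.+ (toℕ j ℕ.+ toℕ l) % m) % m      ≡⟨ cong (λ z → (toℕ i ℕ.+ z) % m) (toℕ-mod _) ⟨
    (toℕ i ℕ.+ toℕ (j +ₖ l)) % m               ≡⟨ toℕ-mod _ ⟨
    toℕ (i +ₖ (j +ₖ l))                        ∎)
    where open ≡-Reasoning

  +ₖ-identityʳ : ∀ i → i +ₖ 0ₖ ≡ i
  +ₖ-identityʳ i = trans (cong (i ⊕_) toℕ-0ₖ) (i⊕0≡i i)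

  +ₖ-inverseʳ : ∀ i → i +ₖ -ₖ i ≡ 0ₖ
  +ₖ-inverseʳ i = toℕ-injective (begin
    toℕ (i +ₖ -ₖ i)                      ≡⟨ toℕ-mod _ ⟩
    (toℕ i ℕ.+ toℕ (-ₖ i)) % m           ≡⟨ cong (λ z → (toℕ i ℕ.+ z) % m) (toℕ-mod (m ∸ toℕ i)) ⟩
    (toℕ i ℕ.+ (m ∸ toℕ i) % m) % m      ≡⟨ [x+y%m]%m≡[x+y]%m (toℕ i) (m ∸ toℕ i) ⟩
    (toℕ i ℕ.+ (m ∸ toℕ i)) % m          ≡⟨ cong (_% m) (m+[n∸m]≡n (<⇒≤ (toℕ<n i))) ⟩
    m % m                                ≡⟨ trans (n%n≡0 m) (sym toℕ-0ₖ) ⟩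
    toℕ 0ₖ                               ∎)
    where open ≡-Reasoning

  +ₖ-isAbelianGroup : IsAbelianGroup _≡_ _+ₖ_ 0ₖ (λ i → -ₖ i)
  +ₖ-isAbelianGroup = record
    { isGroup = record
      { isMonoid = record
        { isSemigroup = record
          { isMagma = record { isEquivalence = ≡.isEquivalence ; ∙-cong = cong₂ _+ₖ_ }
          ; assoc = +ₖ-assoc }
        ; identity = (λ i → trans (+ₖ-comm 0ₖ i) (+ₖ-identityʳ i)) , +ₖ-identityʳ }
      ; inverse = (λ i → trans (+ₖ-comm (-ₖ i) i) (+ₖ-inverseʳ i)) , +ₖ-inverseʳ
      ; ⁻¹-cong = cong (λ i → -ₖ i) }
    ; comm = +ₖ-comm }

  +ₖ-abelianGroup : AbelianGroup _ _
  +ₖ-abelianGroup = record { isAbelianGroup = +ₖ-isAbelianGroup }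

  open AbelianGroup +ₖ-abelianGroup public using () renaming (identityˡ to +ₖ-identityˡ)
  open import Algebra.Properties.AbelianGroup +ₖ-abelianGroup
    using (//-rightDividesˡ; //-rightDividesʳ; ε⁻¹≈ε; ⁻¹-anti-homo-//; xyx⁻¹≈y)
  open import Algebra.Properties.AbelianGroup +ₖ-abelianGroup public
    using (x∙y⁻¹≈ε⇒x≈y)

  i-0≡i : ∀ i → i -ₖ 0ₖ ≡ i
  i-0≡i i = trans (cong (i +ₖ_) ε⁻¹≈ε) (+ₖ-identityʳ i)

  [i+g]-g≡i : ∀ i g → (i +ₖ g) -ₖ g ≡ i
  [i+g]-g≡i i g = //-rightDividesʳ g i

  g-[g-i]≡i : ∀ g i → g -ₖ (g -ₖ i) ≡ i
  g-[g-i]≡i g i = begin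
    g +ₖ -ₖ (g -ₖ i)    ≡⟨ cong (g +ₖ_) (⁻¹-anti-homo-// g i) ⟩
    g +ₖ (i -ₖ g)       ≡⟨ +ₖ-assoc g i (-ₖ g) ⟨
    g +ₖ i -ₖ g         ≡⟨ xyx⁻¹≈y g i ⟩
    i                   ∎
    where open ≡-Reasoning

  q-[p-i]≡i+[q-p] : ∀ q p i → q -ₖ (p -ₖ i) ≡ i +ₖ (q -ₖ p)
  q-[p-i]≡i+[q-p] q p i = begin
    q +ₖ -ₖ (p -ₖ i)    ≡⟨ cong (q +ₖ_) (⁻¹-anti-homo-// p i) ⟩
    q +ₖ (i -ₖ p)       ≡⟨ +ₖ-assoc q i (-ₖ p) ⟨
    q +ₖ i -ₖ p         ≡⟨ cong (_-ₖ p) (+ₖ-comm q i) ⟩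
    i +ₖ q -ₖ p         ≡⟨ +ₖ-assoc i q (-ₖ p) ⟩
    i +ₖ (q -ₖ p)       ∎
    where open ≡-Reasoning

  translation : Fin m → Permutation′ m
  translation g = permutation (_+ₖ g) (_-ₖ g) (λ i → //-rightDividesˡ g i) (λ i → [i+g]-g≡i i g)

  reflection : Fin m → Permutation′ m
  reflection g = permutation (λ i → g -ₖ i) (λ i → g -ₖ i) (g-[g-i]≡i g) (g-[g-i]≡i g)

  toℕ≡0⇒≡0ₖ : ∀ {g} → toℕ g ≡ 0 → g ≡ 0ₖ
  toℕ≡0⇒≡0ₖ g≡0 = toℕ-injective (trans g≡0 (sym toℕ-0ₖ))

  1≤toℕ⇒≢0ₖ : ∀ {g} → 1 ≤ toℕ g → ¬ 0ₖ ≡ g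
  1≤toℕ⇒≢0ₖ 1≤g refl = 1+n≰n (subst (1 ≤_) toℕ-0ₖ 1≤g)

  ⌊m/2⌋<m : ⌊ m /2⌋ < m
  ⌊m/2⌋<m = subst (λ x → ⌊ x /2⌋ < x) (suc-pred m) (⌊n/2⌋<n (ℕ.pred m))

  ≤m∸1⇒<m : ∀ {j} → j ≤ m ∸ 1 → j < m
  ≤m∸1⇒<m {j} j≤ = m≤pred[n]⇒suc[m]≤n (subst (j ≤_) (sym (pred[m∸n]≡m∸[1+n] m 0)) j≤)

  toℕ-neg-0 : ∀ {g} → toℕ g ≡ 0 → toℕ (-ₖ g) ≡ 0
  toℕ-neg-0 g≡0 = trans (cong (λ g → toℕ (-ₖ g)) (toℕ≡0⇒≡0ₖ g≡0)) (trans (cong toℕ ε⁻¹≈ε) toℕ-0ₖ)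

  toℕ-neg : ∀ {g} → 1 ≤ toℕ g → toℕ (-ₖ g) ≡ m ∸ toℕ g
  toℕ-neg {g} 1≤g = toℕ-mod-< (∸-monoʳ-< 1≤g (<⇒≤ (toℕ<n g)))

  1≤toℕ-neg : ∀ {g} → 1 ≤ toℕ g → 1 ≤ toℕ (-ₖ g)
  1≤toℕ-neg {g} 1≤g = subst (1 ≤_) (sym (toℕ-neg 1≤g)) (m<n⇒0<n∸m (toℕ<n g))

  toℕ-neg≤⌊m/2⌋ : ∀ {g} → ⌊ m /2⌋ < toℕ g → toℕ (-ₖ g) ≤ ⌊ m /2⌋
  toℕ-neg≤⌊m/2⌋ {g} lt = subst (_≤ ⌊ m /2⌋) (sym (toℕ-neg (≤-trans (s≤s z≤n) lt))) (⌊m/2⌋<n⇒m∸n≤⌊m/2⌋ m lt)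

-- One constructor for each range of shifts (g, h) constrained by conditions (iii)–(v).
module HalfShifts (k n : ℕ) .{{_ : NonZero k}} .{{_ : NonZero n}} where
  open ℕₚ using (n≢0⇒n>0; ≰⇒>)
  private
    module K = Cyclic k
    module N = Cyclic n

  data HalfShift (g : Fin k) (h : Fin n) : Set where
    origin       : toℕ g ≡ 0 → toℕ h ≡ 0 → HalfShift g h
    inBlock      : toℕ g ≡ 0 → 1 ≤ toℕ h → toℕ h ≤ ⌊ n /2⌋ → HalfShift g h
    acrossBlocks : 1 ≤ toℕ g → toℕ g ≤ ⌊ k /2⌋ → toℕ h ≡ 0 → HalfShift g h
    general      : 1 ≤ toℕ g → 1 ≤ toℕ h → toℕ h ≤ ⌊ n /2⌋ → HalfShift g h

  halfShift⊎mirror : ∀ g h → HalfShift g h ⊎ HalfShift (K.-ₖ g) (N.-ₖ h)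
  halfShift⊎mirror g h with toℕ g ≟ 0 | toℕ h ≟ 0
  ... | yes g≡0 | yes h≡0 = inj₁ (origin g≡0 h≡0)
  ... | yes g≡0 | no h≢0 with toℕ h ≤? ⌊ n /2⌋
  ...   | yes h≤ = inj₁ (inBlock g≡0 (n≢0⇒n>0 h≢0) h≤)
  ...   | no h≰  = inj₂ (inBlock (K.toℕ-neg-0 g≡0) (N.1≤toℕ-neg (n≢0⇒n>0 h≢0)) (N.toℕ-neg≤⌊m/2⌋ (≰⇒> h≰)))
  halfShift⊎mirror g h | no g≢0 | yes h≡0 with toℕ g ≤? ⌊ k /2⌋
  ...   | yes g≤ = inj₁ (acrossBlocks (n≢0⇒n>0 g≢0) g≤ h≡0)
  ...   | no g≰  = inj₂ (acrossBlocks (K.1≤toℕ-neg (n≢0⇒n>0 g≢0)) (K.toℕ-neg≤⌊m/2⌋ (≰⇒> g≰)) (N.toℕ-neg-0 h≡0))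
  halfShift⊎mirror g h | no g≢0 | no h≢0 with toℕ h ≤? ⌊ n /2⌋
  ...   | yes h≤ = inj₁ (general (n≢0⇒n>0 g≢0) (n≢0⇒n>0 h≢0) h≤)
  ...   | no h≰  = inj₂ (general (K.1≤toℕ-neg (n≢0⇒n>0 g≢0)) (N.1≤toℕ-neg (n≢0⇒n>0 h≢0)) (N.toℕ-neg≤⌊m/2⌋ (≰⇒> h≰)))

module Matrices {c ℓ} (R : CommutativeRing c ℓ) where
  open CommutativeRing R
  open Over R
  open import Algebra.Properties.Semiring.Sum semiring public
    using (sum-cong-≋; sum-replicate; sum-replicate-zero; ∑-distrib-+; ∑-comm; sum-permute; *-distribˡ-sum; *-distribʳ-sum)
  open import Algebra.Properties.AbelianGroup +-abelianGroup public
    using (ε⁻¹≈ε; ⁻¹-∙-comm; ⁻¹-involutive; inverseˡ-unique; inverseʳ-unique; identityˡ-unique)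
  open import Algebra.Properties.Ring ring public using (-‿distribˡ-*; -‿distribʳ-*)
  open import Algebra.Properties.CommutativeSemigroup *-commutativeSemigroup using (x∙yz≈y∙xz)
  import Algebra.Properties.Semiring.Mult semiring as Mult
  open import Relation.Binary.Reasoning.Setoid setoid

  sum-const : ∀ m x → sum {m} (λ _ → x) ≈ (m ·ℕ 1#) * x
  sum-const m x = begin
    sum {m} (λ _ → x)  ≈⟨ sum-replicate m ⟩
    m ·ℕ x             ≈⟨ Mult.×-congʳ m (*-identityˡ x) ⟨
    m ·ℕ (1# * x)      ≈⟨ Mult.×-assoc-* m 1# x ⟨
    (m ·ℕ 1#) * x      ∎

  x+[y+z]≈0⇒z≈-x-y : ∀ {x y z} → x + (y + z) ≈ 0# → z ≈ - x - y
  x+[y+z]≈0⇒z≈-x-y eq = trans (inverseʳ-unique _ _ (trans (+-assoc _ _ _) eq)) (sym (⁻¹-∙-comm _ _))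

  z≈-x-y⇒x+[y+z]≈0 : ∀ {x y z} → z ≈ - x - y → x + (y + z) ≈ 0#
  z≈-x-y⇒x+[y+z]≈0 {x} {y} eq =
    trans (sym (+-assoc _ _ _)) (trans (+-congˡ (trans eq (⁻¹-∙-comm x y))) (-‿inverseʳ (x + y)))

  sum-neg : ∀ {m} (f : Fin m → Carrier) → sum (λ i → - f i) ≈ - sum f
  sum-neg {zero}  f = sym ε⁻¹≈ε
  sum-neg {suc m} f = trans (+-congˡ (sum-neg (λ i → f (Fin.suc i)))) (⁻¹-∙-comm _ _)

  sum-splitAt : ∀ m n (f : Fin (m ℕ.+ n) → Carrier) →
                sum f ≈ sum (λ i → f (i ↑ˡ n)) + sum (λ j → f (m ↑ʳ j))
  sum-splitAt zero    n f = sym (+-identityˡ _)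
  sum-splitAt (suc m) n f = trans (+-congˡ (sum-splitAt m n (f ∘ Fin.suc))) (sym (+-assoc _ _ _))

  sum-combine : ∀ k n (f : Fin (k ℕ.* n) → Carrier) →
                sum f ≈ sum (λ p → sum (λ u → f (combine {k} {n} p u)))
  sum-combine zero    n f = refl
  sum-combine (suc k) n f = trans (sum-splitAt n (k ℕ.* n) f) (+-congˡ (sum-combine k n (λ r → f (n ↑ʳ r))))

  ∑∑-cong : ∀ {k n} {F G : Fin k → Fin n → Carrier} → (∀ i s → F i s ≈ G i s) →
            sum (λ i → sum (λ s → F i s)) ≈ sum (λ i → sum (λ s → G i s))
  ∑∑-cong F≈G = sum-cong-≋ (λ i → sum-cong-≋ (F≈G i))

  ∑∑-permute : ∀ {k n} (π : Permutation′ k) (σ : Permutation′ n) (F : Fin k → Fin n → Carrier) →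
               sum (λ i → sum (λ s → F i s)) ≈ sum (λ i → sum (λ s → F (π ⟨$⟩ʳ i) (σ ⟨$⟩ʳ s)))
  ∑∑-permute π σ F = trans (sum-permute (λ i → sum (F i)) π) (sum-cong-≋ (λ i → sum-permute (F (π ⟨$⟩ʳ i)) σ))

  ∑-bilinear : ∀ {m m′ N} (λs : Fin m → Carrier) (μs : Fin m′ → Carrier) (A : Mat m N) (B : Mat m′ N) →
               sum (λ l → sum (λ i → λs i * A i l) * sum (λ j → μs j * B j l))
               ≈ sum (λ i → sum (λ j → λs i * μs j * sum (λ l → A i l * B j l)))
  ∑-bilinear λs μs A B = begin
    sum (λ l → sum (λ i → λs i * A i l) * sum (λ j → μs j * B j l))
      ≈⟨ sum-cong-≋ (λ l → *-distribʳ-sum _ (λ i → λs i * A i l)) ⟩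
    sum (λ l → sum (λ i → λs i * A i l * sum (λ j → μs j * B j l)))
      ≈⟨ sum-cong-≋ (λ l → sum-cong-≋ (λ i → *-distribˡ-sum (λs i * A i l) (λ j → μs j * B j l))) ⟩
    sum (λ l → sum (λ i → sum (λ j → λs i * A i l * (μs j * B j l))))
      ≈⟨ ∑-comm (λ l i → sum (λ j → λs i * A i l * (μs j * B j l))) ⟩
    sum (λ i → sum (λ l → sum (λ j → λs i * A i l * (μs j * B j l))))
      ≈⟨ sum-cong-≋ (λ i → ∑-comm (λ l j → λs i * A i l * (μs j * B j l))) ⟩
    sum (λ i → sum (λ j → sum (λ l → λs i * A i l * (μs j * B j l))))
      ≈⟨ sum-cong-≋ (λ i → sum-cong-≋ (λ j → sum-cong-≋ (λ l → interchange (λs i) (A i l) (μs j) (B j l)))) ⟩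
    sum (λ i → sum (λ j → sum (λ l → λs i * μs j * (A i l * B j l))))
      ≈⟨ sum-cong-≋ (λ i → sum-cong-≋ (λ j → sym (*-distribˡ-sum _ (λ l → A i l * B j l)))) ⟩
    sum (λ i → sum (λ j → λs i * μs j * sum (λ l → A i l * B j l))) ∎
    where
    interchange : ∀ w x y z → w * x * (y * z) ≈ w * y * (x * z)
    interchange w x y z = begin
      w * x * (y * z)   ≈⟨ *-assoc w x (y * z) ⟩
      w * (x * (y * z)) ≈⟨ *-congˡ (x∙yz≈y∙xz x y z) ⟩
      w * (y * (x * z)) ≈⟨ *-assoc w y (x * z) ⟨
      w * y * (x * z)   ∎

  idMat-diag : ∀ {m} (i : Fin m) → idMat i i ≡ 1#
  idMat-diag Fin.zero    = ≡.refl
  idMat-diag (Fin.suc i) = idMat-diag i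

  idMat-off : ∀ {m} {i j : Fin m} → ¬ i ≡ j → idMat i j ≡ 0#
  idMat-off {i = Fin.zero}  {Fin.zero}  i≢j = contradiction ≡.refl i≢j
  idMat-off {i = Fin.zero}  {Fin.suc j} i≢j = ≡.refl
  idMat-off {i = Fin.suc i} {Fin.zero}  i≢j = ≡.refl
  idMat-off {i = Fin.suc i} {Fin.suc j} i≢j = idMat-off (i≢j ∘ ≡.cong Fin.suc)

  idMat-sym : ∀ {m} (i j : Fin m) → idMat i j ≡ idMat j i
  idMat-sym Fin.zero    Fin.zero    = ≡.refl
  idMat-sym Fin.zero    (Fin.suc j) = ≡.refl
  idMat-sym (Fin.suc i) Fin.zero    = ≡.refl
  idMat-sym (Fin.suc i) (Fin.suc j) = idMat-sym i j

  idMat-cong-⇔ : ∀ {m m′} {i j : Fin m} {i′ j′ : Fin m′} →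
                 (i ≡ j → i′ ≡ j′) → (i′ ≡ j′ → i ≡ j) → idMat i j ≡ idMat i′ j′
  idMat-cong-⇔ {i = i} {j} {i′} {j′} to from with i ≟ᶠ j
  ... | yes ≡.refl = ≡.trans (idMat-diag i) (≡.sym (≡.subst (λ j′ → idMat i′ j′ ≡ 1#) (to ≡.refl) (idMat-diag i′)))
  ... | no i≢j     = ≡.trans (idMat-off i≢j) (≡.sym (idMat-off (i≢j ∘ from)))

  sum-idMat-* : ∀ {m} (i : Fin m) (f : Fin m → Carrier) → sum (λ j → idMat i j * f j) ≈ f i
  sum-idMat-* {suc m} Fin.zero f = begin
    1# * f Fin.zero + sum (λ j → 0# * f (Fin.suc j)) ≈⟨ +-cong (*-identityˡ _) (sum-cong-≋ (λ j → zeroˡ (f (Fin.suc j)))) ⟩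
    f Fin.zero + sum {m} (λ _ → 0#)                  ≈⟨ +-congˡ (sum-replicate-zero m) ⟩
    f Fin.zero + 0#                                  ≈⟨ +-identityʳ _ ⟩
    f Fin.zero                                       ∎
  sum-idMat-* (Fin.suc i) f = trans (+-cong (zeroˡ _) (sum-idMat-* i (λ j → f (Fin.suc j)))) (+-identityˡ _)

  sum-*-idMat : ∀ {m} (i : Fin m) (f : Fin m → Carrier) → sum (λ j → f j * idMat j i) ≈ f i
  sum-*-idMat i f = trans (sum-cong-≋ (λ j → trans (*-comm _ _) (*-congʳ (reflexive (idMat-sym j i))))) (sum-idMat-* i f)

module BorderScalars {c ℓ} (R : CommutativeRing c ℓ) where
  open CommutativeRing R
  open import Algebra.Solver.Ring.NaturalCoefficients.Default commutativeSemiring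
    using (solve; _:=_; _:+_; _:*_; con)
  open import Algebra.Properties.Group +-group using (identityˡ-unique)
  open import Relation.Binary.Reasoning.Setoid setoid

  private
    *≈0 : ∀ x {y} → y ≈ 0# → x * y ≈ 0#
    *≈0 x y≈0 = trans (*-congˡ y≈0) (zeroʳ x)

    +≈0 : ∀ {x y} → x ≈ 0# → y ≈ 0# → x + y ≈ 0#
    +≈0 x≈0 y≈0 = trans (+-cong x≈0 y≈0) (+-identityˡ 0#)

    +0 : ∀ x {y} → y ≈ 0# → x ≈ x + y
    +0 x y≈0 = sym (trans (+-congˡ y≈0) (+-identityʳ x))

  -- With yᵢ = x̄ᵢ, s = S and t = S̄ the hypotheses are border entries of X X̄ᵀ = -I for the
  -- bordered matrix X of bordered-gramᵀ (C sums one row of its Y-block); the conclusions are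
  -- what X̄ᵀ X = -I requires on the border.
  module _ (M x₁ y₁ x₂ y₂ x₃ y₃ s t : Carrier)
    (A  : 1# + (x₁ * y₁ + M * (x₂ * y₂)) ≈ 0#)
    (B  : x₁ * y₃ + x₂ * t ≈ 0#)
    (B′ : x₃ * y₁ + s * y₂ ≈ 0#)
    (C  : 1# + (M * (x₃ * y₃) + s * t) ≈ 0#) where

    x₃y₃≈x₂y₂ : x₃ * y₃ ≈ x₂ * y₂
    x₃y₃≈x₂y₂ = begin
      x₃ * y₃
        ≈⟨ +0 _ (+≈0 (*≈0 (x₂ * y₂) C) (*≈0 (x₃ * y₁) B)) ⟩
      x₃ * y₃ + (x₂ * y₂ * (1# + (M * (x₃ * y₃) + s * t)) + x₃ * y₁ * (x₁ * y₃ + x₂ * t))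
        ≈⟨ solve 9 (λ M x₁ y₁ x₂ y₂ x₃ y₃ s t →
             x₃ :* y₃ :+ (x₂ :* y₂ :* (con 1 :+ (M :* (x₃ :* y₃) :+ s :* t)) :+ x₃ :* y₁ :* (x₁ :* y₃ :+ x₂ :* t))
             := x₂ :* y₂ :+ (x₃ :* y₃ :* (con 1 :+ (x₁ :* y₁ :+ M :* (x₂ :* y₂))) :+ x₂ :* t :* (x₃ :* y₁ :+ s :* y₂)))
             refl M x₁ y₁ x₂ y₂ x₃ y₃ s t ⟩
      x₂ * y₂ + (x₃ * y₃ * (1# + (x₁ * y₁ + M * (x₂ * y₂))) + x₂ * t * (x₃ * y₁ + s * y₂))
        ≈⟨ +0 _ (+≈0 (*≈0 (x₃ * y₃) A) (*≈0 (x₂ * t) B′)) ⟨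
      x₂ * y₂ ∎

    x₁y₂+x₃t≈0 : x₁ * y₂ + x₃ * t ≈ 0#
    x₁y₂+x₃t≈0 = begin
      w                                    ≈⟨ +0 w (+≈0 (*≈0 (M * x₃) wy₃≈0) (*≈0 t ws≈0)) ⟩
      w + (M * x₃ * (w * y₃) + t * (w * s)) ≈⟨ solve 6 (λ M x₃ y₃ s t w →
             w :+ (M :* x₃ :* (w :* y₃) :+ t :* (w :* s)) := w :* (con 1 :+ (M :* (x₃ :* y₃) :+ s :* t)))
             refl M x₃ y₃ s t w ⟩
      w * (1# + (M * (x₃ * y₃) + s * t))    ≈⟨ *≈0 w C ⟩
      0#                                   ∎
      where
      w = x₁ * y₂ + x₃ * t

      C₂ : 1# + (M * (x₂ * y₂) + s * t) ≈ 0#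
      C₂ = trans (+-congˡ (+-congʳ (*-congˡ (sym x₃y₃≈x₂y₂)))) C

      ws≈0 : w * s ≈ 0#
      ws≈0 = identityˡ-unique _ (x₃ * (1# + (x₁ * y₁ + M * (x₂ * y₂)))) (begin
        w * s + x₃ * (1# + (x₁ * y₁ + M * (x₂ * y₂)))
          ≈⟨ solve 8 (λ M x₁ y₁ x₂ y₂ x₃ s t →
               (x₁ :* y₂ :+ x₃ :* t) :* s :+ x₃ :* (con 1 :+ (x₁ :* y₁ :+ M :* (x₂ :* y₂)))
               := x₁ :* (x₃ :* y₁ :+ s :* y₂) :+ x₃ :* (con 1 :+ (M :* (x₂ :* y₂) :+ s :* t)))
               refl M x₁ y₁ x₂ y₂ x₃ s t ⟩
        x₁ * (x₃ * y₁ + s * y₂) + x₃ * (1# + (M * (x₂ * y₂) + s * t))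
          ≈⟨ +≈0 (*≈0 x₁ B′) (*≈0 x₃ C₂) ⟩
        0#
          ≈⟨ *≈0 x₃ A ⟨
        x₃ * (1# + (x₁ * y₁ + M * (x₂ * y₂))) ∎)

      wy₃≈0 : w * y₃ ≈ 0#
      wy₃≈0 = identityˡ-unique _ (t * (x₂ * y₂)) (begin
        w * y₃ + t * (x₂ * y₂)
          ≈⟨ solve 6 (λ x₁ y₂ x₂ x₃ y₃ t →
               (x₁ :* y₂ :+ x₃ :* t) :* y₃ :+ t :* (x₂ :* y₂) := y₂ :* (x₁ :* y₃ :+ x₂ :* t) :+ t :* (x₃ :* y₃))
               refl x₁ y₂ x₂ x₃ y₃ t ⟩
        y₂ * (x₁ * y₃ + x₂ * t) + t * (x₃ * y₃)
          ≈⟨ +-cong (*≈0 y₂ B) (*-congˡ x₃y₃≈x₂y₂) ⟩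
        0# + t * (x₂ * y₂)
          ≈⟨ +-identityˡ _ ⟩
        t * (x₂ * y₂) ∎)

module Involutive {c ℓ} (R : CommutativeRing c ℓ)
  (bar : CommutativeRing.Carrier R → CommutativeRing.Carrier R)
  (inv : Over.IsNontrivialInvolution R bar) where
  open CommutativeRing R
  open Over R
  open WithInvolution bar
  open Matrices R
  open BorderScalars R
  open IsNontrivialInvolution inv renaming (cong to bar-cong)
  open import Relation.Binary.Reasoning.Setoid setoid

  bar-0# : bar 0# ≈ 0#
  bar-0# = identityˡ-unique _ _ (trans (sym (+-hom 0# 0#)) (bar-cong (+-identityˡ 0#)))

  bar-sum : ∀ {m} (f : Fin m → Carrier) → bar (sum f) ≈ sum (λ i → bar (f i))
  bar-sum {zero}  f = bar-0#
  bar-sum {suc m} f = trans (+-hom _ _) (+-congˡ (bar-sum (λ i → f (Fin.suc i))))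

  bar-idMat : ∀ {m} (i j : Fin m) → bar (idMat i j) ≈ idMat i j
  bar-idMat Fin.zero    Fin.zero    = 1-hom
  bar-idMat Fin.zero    (Fin.suc j) = bar-0#
  bar-idMat (Fin.suc i) Fin.zero    = bar-0#
  bar-idMat (Fin.suc i) (Fin.suc j) = bar-idMat i j

  sum-*-bar : ∀ {m} x (f : Fin m → Carrier) → sum (λ i → x * bar (f i)) ≈ x * bar (sum f)
  sum-*-bar x f = trans (sym (*-distribˡ-sum x (λ i → bar (f i)))) (*-congˡ (sym (bar-sum f)))

  bar-*-bar : ∀ x y → bar (x * bar y) ≈ y * bar x
  bar-*-bar x y = trans (*-hom x (bar y)) (trans (*-congˡ (involutive y)) (*-comm _ _))

  bar-⟨⟩H : ∀ {m} (x y : Fin m → Carrier) → bar ⟨ x , y ⟩H ≈ ⟨ y , x ⟩H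
  bar-⟨⟩H x y = trans (bar-sum (λ i → x i * bar (y i))) (sum-cong-≋ (λ i → bar-*-bar (x i) (y i)))

  _ᵀ : ∀ {m n} → Mat m n → Mat n m
  (A ᵀ) i j = A j i

  I+Gram : ∀ {m n} → Mat m n → Fin m → Fin m → Carrier
  I+Gram A i j = idMat i j + ⟨ A i , A j ⟩H

  GramIsMinusId : ∀ {m n} → Mat m n → Set ℓ
  GramIsMinusId A = ∀ i j → I+Gram A i j ≈ 0#

  gram-flip : ∀ {m n} (A : Mat m n) {i j} → I+Gram A i j ≈ 0# → I+Gram A j i ≈ 0#
  gram-flip A {i} {j} eq = begin
    idMat j i + ⟨ A j , A i ⟩H            ≈⟨ +-cong (reflexive (idMat-sym j i)) (sym (bar-⟨⟩H (A i) (A j))) ⟩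
    idMat i j + bar ⟨ A i , A j ⟩H        ≈⟨ +-congʳ (sym (bar-idMat i j)) ⟩
    bar (idMat i j) + bar ⟨ A i , A j ⟩H  ≈⟨ sym (+-hom _ _) ⟩
    bar (idMat i j + ⟨ A i , A j ⟩H)      ≈⟨ bar-cong eq ⟩
    bar 0#                                ≈⟨ bar-0# ⟩
    0#                                    ∎

  ⟨linComb,linComb⟩H : ∀ {m m′ n} (λs : Fin m → Carrier) (μs : Fin m′ → Carrier) (A : Mat m n) (B : Mat m′ n) →
                       ⟨ (λ l → sum (λ i → λs i * A i l)) , (λ l → sum (λ j → μs j * B j l)) ⟩H
                       ≈ sum (λ i → sum (λ j → λs i * bar (μs j) * ⟨ A i , B j ⟩H))
  ⟨linComb,linComb⟩H λs μs A B = begin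
    sum (λ l → sum (λ i → λs i * A i l) * bar (sum (λ j → μs j * B j l)))
      ≈⟨ sum-cong-≋ (λ l → *-congˡ (trans (bar-sum (λ j → μs j * B j l)) (sum-cong-≋ (λ j → *-hom (μs j) (B j l))))) ⟩
    sum (λ l → sum (λ i → λs i * A i l) * sum (λ j → bar (μs j) * bar (B j l)))
      ≈⟨ ∑-bilinear λs (λ j → bar (μs j)) A (λ j l → bar (B j l)) ⟩
    sum (λ i → sum (λ j → λs i * bar (μs j) * ⟨ A i , B j ⟩H)) ∎

  ∑⟨y,Xᵢ⟩Xᵢₗ≈-yₗ : ∀ {m n} (X : Mat m n) → GramIsMinusId (X ᵀ) →
                   ∀ (y : Fin n → Carrier) l → sum (λ i → ⟨ y , X i ⟩H * X i l) ≈ - y l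
  ∑⟨y,Xᵢ⟩Xᵢₗ≈-yₗ X gramᵀ y l = begin
    sum (λ i → ⟨ y , X i ⟩H * X i l)
      ≈⟨ sum-cong-≋ (λ i → trans (*-distribʳ-sum (X i l) (λ l′ → y l′ * bar (X i l′)))
                                (sum-cong-≋ (λ l′ → rearrange (y l′) (bar (X i l′)) (X i l)))) ⟩
    sum (λ i → sum (λ l′ → y l′ * (X i l * bar (X i l′))))
      ≈⟨ ∑-comm (λ i l′ → y l′ * (X i l * bar (X i l′))) ⟩
    sum (λ l′ → sum (λ i → y l′ * (X i l * bar (X i l′))))
      ≈⟨ sum-cong-≋ (λ l′ → sym (*-distribˡ-sum (y l′) (λ i → X i l * bar (X i l′)))) ⟩
    sum (λ l′ → y l′ * ⟨ (X ᵀ) l , (X ᵀ) l′ ⟩H)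
      ≈⟨ sum-cong-≋ (λ l′ → *-congˡ (inverseʳ-unique _ _ (gramᵀ l l′))) ⟩
    sum (λ l′ → y l′ * - idMat l l′)
      ≈⟨ sum-cong-≋ (λ l′ → sym (-‿distribʳ-* (y l′) (idMat l l′))) ⟩
    sum (λ l′ → - (y l′ * idMat l l′))
      ≈⟨ sum-neg (λ l′ → y l′ * idMat l l′) ⟩
    - sum (λ l′ → y l′ * idMat l l′)
      ≈⟨ -‿cong (trans (sum-cong-≋ (λ l′ → *-congˡ (reflexive (idMat-sym l l′)))) (sum-*-idMat l y)) ⟩
    - y l ∎
    where
    rearrange : ∀ u v w → u * v * w ≈ u * (w * v)
    rearrange u v w = trans (*-assoc u v w) (*-congˡ (*-comm v w))

  module _ {N} (X : Mat N N) where

    G : Mat N (N ℕ.+ N)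
    G = idMat ∣∣ X

    G-↑ˡ : ∀ i l → G i (l ↑ˡ N) ≡ idMat i l
    G-↑ˡ i l = ≡.cong [ idMat i , X i ]′ (splitAt-↑ˡ N l N)

    G-↑ʳ : ∀ i l → G i (N ↑ʳ l) ≡ X i l
    G-↑ʳ i l = ≡.cong [ idMat i , X i ]′ (splitAt-↑ʳ N N l)

    ⟨x,Gj⟩H : ∀ (x : Fin (N ℕ.+ N) → Carrier) j →
              ⟨ x , G j ⟩H ≈ x (j ↑ˡ N) + ⟨ (λ l → x (N ↑ʳ l)) , X j ⟩H
    ⟨x,Gj⟩H x j = begin
      ⟨ x , G j ⟩H
        ≈⟨ sum-splitAt N N (λ l → x l * bar (G j l)) ⟩
      sum (λ l → x (l ↑ˡ N) * bar (G j (l ↑ˡ N))) + sum (λ l → x (N ↑ʳ l) * bar (G j (N ↑ʳ l)))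
        ≈⟨ +-cong (sum-cong-≋ (λ l → *-congˡ (trans (bar-cong (reflexive (G-↑ˡ j l)))
                                              (trans (bar-idMat j l) (reflexive (idMat-sym j l))))))
                  (sum-cong-≋ (λ l → *-congˡ (bar-cong (reflexive (G-↑ʳ j l))))) ⟩
      sum (λ l → x (l ↑ˡ N) * idMat l j) + ⟨ (λ l → x (N ↑ʳ l)) , X j ⟩H
        ≈⟨ +-congʳ (sum-*-idMat j (λ l → x (l ↑ˡ N))) ⟩
      x (j ↑ˡ N) + ⟨ (λ l → x (N ↑ʳ l)) , X j ⟩H ∎

    ⟨Gi,Gj⟩H : ∀ i j → ⟨ G i , G j ⟩H ≈ idMat i j + ⟨ X i , X j ⟩H
    ⟨Gi,Gj⟩H i j = trans (⟨x,Gj⟩H (G i) j)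
      (+-cong (reflexive (G-↑ˡ i j)) (sum-cong-≋ (λ l → *-congʳ (reflexive (G-↑ʳ i l)))))

    row∈RowSpan : ∀ i → RowSpan G (G i)
    row∈RowSpan i = idMat i , λ l → sym (sum-idMat-* i (λ i′ → G i′ l))

    selfDual⇒gram : IsHermitianSelfDual (RowSpan G) → GramIsMinusId X
    selfDual⇒gram selfDual i j =
      trans (sym (⟨Gi,Gj⟩H i j)) (proj₁ (selfDual (G i)) (row∈RowSpan i) (G j) (row∈RowSpan j))

    rowSpan⊆dual : GramIsMinusId X → ∀ {x} → RowSpan G x → HermitianDual (RowSpan G) x
    rowSpan⊆dual gram {x} (λs , x≈) y (μs , y≈) = begin
      ⟨ x , y ⟩H
        ≈⟨ sum-cong-≋ (λ l → *-cong (x≈ l) (bar-cong (y≈ l))) ⟩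
      ⟨ (λ l → sum (λ i → λs i * G i l)) , (λ l → sum (λ j → μs j * G j l)) ⟩H
        ≈⟨ ⟨linComb,linComb⟩H λs μs G G ⟩
      sum (λ i → sum (λ j → λs i * bar (μs j) * ⟨ G i , G j ⟩H))
        ≈⟨ sum-cong-≋ (λ i → sum-cong-≋ (λ j → trans (*-congˡ (trans (⟨Gi,Gj⟩H i j) (gram i j))) (zeroʳ _))) ⟩
      sum {N} (λ i → sum {N} (λ j → 0#))
        ≈⟨ trans (sum-cong-≋ {N} (λ i → sum-replicate-zero N)) (sum-replicate-zero N) ⟩
      0# ∎

    dual⊆rowSpan : GramIsMinusId (X ᵀ) → ∀ {x} → HermitianDual (RowSpan G) x → RowSpan G x
    dual⊆rowSpan gramᵀ {x} dual = x₁ , ↑ˡ-↑ʳ-elim left right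
      where
      x₁ x₂ : Fin N → Carrier
      x₁ l = x (l ↑ˡ N)
      x₂ l = x (N ↑ʳ l)

      x₁≈ : ∀ i → x₁ i ≈ - ⟨ x₂ , X i ⟩H
      x₁≈ i = inverseˡ-unique _ _ (trans (sym (⟨x,Gj⟩H x i)) (dual (G i) (row∈RowSpan i)))

      left : ∀ l → x (l ↑ˡ N) ≈ sum (λ i → x₁ i * G i (l ↑ˡ N))
      left l = sym (trans (sum-cong-≋ (λ i → *-congˡ (reflexive (G-↑ˡ i l)))) (sum-*-idMat l x₁))

      right : ∀ l → x (N ↑ʳ l) ≈ sum (λ i → x₁ i * G i (N ↑ʳ l))
      right l = sym (begin
        sum (λ i → x₁ i * G i (N ↑ʳ l))          ≈⟨ sum-cong-≋ (λ i → *-cong (x₁≈ i) (reflexive (G-↑ʳ i l))) ⟩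
        sum (λ i → - ⟨ x₂ , X i ⟩H * X i l)      ≈⟨ sum-cong-≋ (λ i → sym (-‿distribˡ-* ⟨ x₂ , X i ⟩H (X i l))) ⟩
        sum (λ i → - (⟨ x₂ , X i ⟩H * X i l))    ≈⟨ sum-neg (λ i → ⟨ x₂ , X i ⟩H * X i l) ⟩
        - sum (λ i → ⟨ x₂ , X i ⟩H * X i l)      ≈⟨ -‿cong (∑⟨y,Xᵢ⟩Xᵢₗ≈-yₗ X gramᵀ x₂ l) ⟩
        - - x₂ l                                 ≈⟨ ⁻¹-involutive _ ⟩
        x₂ l                                     ∎)

    grams⇒selfDual : GramIsMinusId X → GramIsMinusId (X ᵀ) → IsHermitianSelfDual (RowSpan G)
    grams⇒selfDual gram gramᵀ x = rowSpan⊆dual gram , dual⊆rowSpan gramᵀ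

  module _ {m} (r₀ : Fin m) (x₁ x₂ x₃ S : Carrier) (Y : Mat m m)
    (rowSum : ∀ r → sum (Y r) ≈ S) (colSum : ∀ l → sum (λ r → Y r l) ≈ S)
    (normal : ∀ r r′ → ⟨ (Y ᵀ) r , (Y ᵀ) r′ ⟩H ≈ ⟨ Y r′ , Y r ⟩H) where

    private
      X : Mat (ℕ.suc m) (ℕ.suc m)
      X = borderMat x₁ x₂ x₃ Y

      M : Carrier
      M = m ·ℕ 1#

      x*bar-sum : ∀ x (f : Fin m → Carrier) → sum f ≈ S → sum (λ l → x * bar (f l)) ≈ x * bar S
      x*bar-sum x f ∑f≈S = trans (sum-*-bar x f) (*-congˡ (bar-cong ∑f≈S))

    bordered-gramᵀ : GramIsMinusId X → GramIsMinusId (X ᵀ)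
    bordered-gramᵀ gram = gramᵀ
      where
      A : 1# + (x₁ * bar x₁ + M * (x₂ * bar x₂)) ≈ 0#
      A = trans (+-congˡ (+-congˡ (sym (sum-const m (x₂ * bar x₂))))) (gram Fin.zero Fin.zero)

      B : x₁ * bar x₃ + x₂ * bar S ≈ 0#
      B = begin
        x₁ * bar x₃ + x₂ * bar S                           ≈⟨ +-congˡ (x*bar-sum x₂ (Y r₀) (rowSum r₀)) ⟨
        x₁ * bar x₃ + sum (λ l → x₂ * bar (Y r₀ l))        ≈⟨ +-identityˡ _ ⟨
        0# + (x₁ * bar x₃ + sum (λ l → x₂ * bar (Y r₀ l))) ≈⟨ gram Fin.zero (Fin.suc r₀) ⟩
        0#                                                 ∎

      B′ : x₃ * bar x₁ + S * bar x₂ ≈ 0#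
      B′ = begin
        x₃ * bar x₁ + S * bar x₂                           ≈⟨ +-congˡ (*-congʳ (rowSum r₀)) ⟨
        x₃ * bar x₁ + sum (Y r₀) * bar x₂                  ≈⟨ +-congˡ (*-distribʳ-sum (bar x₂) (Y r₀)) ⟩
        x₃ * bar x₁ + sum (λ l → Y r₀ l * bar x₂)          ≈⟨ +-identityˡ _ ⟨
        0# + (x₃ * bar x₁ + sum (λ l → Y r₀ l * bar x₂))   ≈⟨ gram (Fin.suc r₀) Fin.zero ⟩
        0#                                                 ∎

      C : 1# + (M * (x₃ * bar x₃) + S * bar S) ≈ 0#
      C = begin
        1# + (M * γ + S * bar S)
          ≈⟨ +-cong (sum-idMat-* r₀ (λ _ → 1#)) (+-cong (sum-const m γ) ∑⟨Yr₀,Yr⟩H) ⟨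
        sum (λ r → idMat r₀ r * 1#) + (sum {m} (λ _ → γ) + sum (λ r → ⟨ Y r₀ , Y r ⟩H))
          ≈⟨ +-cong (sum-cong-≋ (λ r → *-identityʳ (idMat r₀ r))) (sym (∑-distrib-+ (λ _ → γ) (λ r → ⟨ Y r₀ , Y r ⟩H))) ⟩
        sum (λ r → idMat r₀ r) + sum (λ r → γ + ⟨ Y r₀ , Y r ⟩H)
          ≈⟨ ∑-distrib-+ (idMat r₀) (λ r → γ + ⟨ Y r₀ , Y r ⟩H) ⟨
        sum (λ r → idMat r₀ r + (γ + ⟨ Y r₀ , Y r ⟩H))
          ≈⟨ sum-cong-≋ (λ r → gram (Fin.suc r₀) (Fin.suc r)) ⟩
        sum {m} (λ _ → 0#)
          ≈⟨ sum-replicate-zero m ⟩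
        0# ∎
        where
        γ = x₃ * bar x₃
        ∑⟨Yr₀,Yr⟩H : sum (λ r → ⟨ Y r₀ , Y r ⟩H) ≈ S * bar S
        ∑⟨Yr₀,Yr⟩H = begin
          sum (λ r → sum (λ l → Y r₀ l * bar (Y r l)))  ≈⟨ ∑-comm (λ r l → Y r₀ l * bar (Y r l)) ⟩
          sum (λ l → sum (λ r → Y r₀ l * bar (Y r l)))  ≈⟨ sum-cong-≋ (λ l → x*bar-sum (Y r₀ l) (λ r → Y r l) (colSum l)) ⟩
          sum (λ l → Y r₀ l * bar S)                    ≈⟨ *-distribʳ-sum (bar S) (Y r₀) ⟨
          sum (Y r₀) * bar S                            ≈⟨ *-congʳ (rowSum r₀) ⟩
          S * bar S                                     ∎

      γ≈ : x₃ * bar x₃ ≈ x₂ * bar x₂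
      γ≈ = x₃y₃≈x₂y₂ M x₁ (bar x₁) x₂ (bar x₂) x₃ (bar x₃) S (bar S) A B B′ C

      gramᵀ₀ : ∀ r → I+Gram (X ᵀ) Fin.zero (Fin.suc r) ≈ 0#
      gramᵀ₀ r = begin
        0# + (x₁ * bar x₂ + sum (λ l → x₃ * bar (Y l r)))  ≈⟨ +-identityˡ _ ⟩
        x₁ * bar x₂ + sum (λ l → x₃ * bar (Y l r))         ≈⟨ +-congˡ (x*bar-sum x₃ (λ l → Y l r) (colSum r)) ⟩
        x₁ * bar x₂ + x₃ * bar S                           ≈⟨ x₁y₂+x₃t≈0 M x₁ (bar x₁) x₂ (bar x₂) x₃ (bar x₃) S (bar S) A B B′ C ⟩
        0#                                                 ∎

      gramᵀ : GramIsMinusId (X ᵀ)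
      gramᵀ Fin.zero    Fin.zero     =
        trans (+-congˡ (+-congˡ (trans (sum-const m (x₃ * bar x₃)) (*-congˡ γ≈)))) A
      gramᵀ Fin.zero    (Fin.suc r)  = gramᵀ₀ r
      gramᵀ (Fin.suc r) Fin.zero     = gram-flip (X ᵀ) {Fin.zero} {Fin.suc r} (gramᵀ₀ r)
      gramᵀ (Fin.suc r) (Fin.suc r′) =
        trans (+-cong (reflexive (idMat-sym r r′)) (+-cong (sym γ≈) (normal r r′))) (gram (Fin.suc r′) (Fin.suc r))

  module BlockCirculant (k n : ℕ) .{{_ : NonZero k}} .{{_ : NonZero n}} (a : Fin k → Fin n → Carrier) where
    module K = Cyclic k
    module N = Cyclic n
    open K using (_⊕_; _+ₖ_; _-ₖ_; -ₖ_; 0ₖ)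
    open N using () renaming (_+ₖ_ to _+ₙ_; _-ₖ_ to _-ₙ_; -ₖ_ to -ₙ_; 0ₖ to 0ₙ)

    ā : Fin k → Fin n → Carrier
    ā i s = bar (a i s)

    ι : Fin k → Fin n → Fin (k ℕ.* n)
    ι = combine

    Y : Mat (k ℕ.* n) (k ℕ.* n)
    Y = blockCirc (λ i → circ (a i))

    S : Carrier
    S = sum (λ i → sum (λ s → a i s))

    T : ℕ → ℕ → Carrier
    T j t = sum (λ i → Θ (a (i ⊕ j)) (ā i) t)

    Y-ι : ∀ p u q w → Y (ι p u) (ι q w) ≡ a (q -ₖ p) (w -ₙ u)
    Y-ι p u q w
      with Fin.quotRem {k} n (combine p u) | ≡.cong swap (remQuot-combine {k} {n} p u)
         | Fin.quotRem {k} n (combine q w) | ≡.cong swap (remQuot-combine {k} {n} q w)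
    ... | _ | ≡.refl | _ | ≡.refl = ≡.cong₂ a (K.⊕-mod q (k ℕ.∸ toℕ p)) (N.⊕-mod w (n ℕ.∸ toℕ u))

    ⟨Y,Y⟩H : ∀ p u p′ u′ → ⟨ Y (ι p u) , Y (ι p′ u′) ⟩H ≈ T (toℕ (p′ -ₖ p)) (toℕ (u′ -ₙ u))
    ⟨Y,Y⟩H p u p′ u′ = begin
      ⟨ Y (ι p u) , Y (ι p′ u′) ⟩H
        ≈⟨ sum-combine k n (λ l → Y (ι p u) l * bar (Y (ι p′ u′) l)) ⟩
      sum (λ q → sum (λ w → Y (ι p u) (ι q w) * bar (Y (ι p′ u′) (ι q w))))
        ≈⟨ ∑∑-cong (λ q w → reflexive (≡.cong₂ (λ x y → x * bar y) (Y-ι p u q w) (Y-ι p′ u′ q w))) ⟩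
      sum (λ q → sum (λ w → a (q -ₖ p) (w -ₙ u) * ā (q -ₖ p′) (w -ₙ u′)))
        ≈⟨ ∑∑-permute (K.translation p′) (N.translation u′) (λ q w → a (q -ₖ p) (w -ₙ u) * ā (q -ₖ p′) (w -ₙ u′)) ⟩
      sum (λ i → sum (λ s → a (i +ₖ p′ -ₖ p) (s +ₙ u′ -ₙ u) * ā (i +ₖ p′ -ₖ p′) (s +ₙ u′ -ₙ u′)))
        ≈⟨ ∑∑-cong (λ i s → reflexive (≡.cong₂ _*_
             (≡.cong₂ a (K.+ₖ-assoc i p′ (-ₖ p)) (N.+ₖ-assoc s u′ (-ₙ u)))
             (≡.cong₂ ā (K.[i+g]-g≡i i p′) (N.[i+g]-g≡i s u′)))) ⟩
      T (toℕ (p′ -ₖ p)) (toℕ (u′ -ₙ u)) ∎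

    ⟨Yᵀ,Yᵀ⟩H : ∀ p u p′ u′ → ⟨ (Y ᵀ) (ι p u) , (Y ᵀ) (ι p′ u′) ⟩H ≈ T (toℕ (p -ₖ p′)) (toℕ (u -ₙ u′))
    ⟨Yᵀ,Yᵀ⟩H p u p′ u′ = begin
      ⟨ (Y ᵀ) (ι p u) , (Y ᵀ) (ι p′ u′) ⟩H
        ≈⟨ sum-combine k n (λ l → Y l (ι p u) * bar (Y l (ι p′ u′))) ⟩
      sum (λ q → sum (λ w → Y (ι q w) (ι p u) * bar (Y (ι q w) (ι p′ u′))))
        ≈⟨ ∑∑-cong (λ q w → reflexive (≡.cong₂ (λ x y → x * bar y) (Y-ι q w p u) (Y-ι q w p′ u′))) ⟩
      sum (λ q → sum (λ w → a (p -ₖ q) (u -ₙ w) * ā (p′ -ₖ q) (u′ -ₙ w)))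
        ≈⟨ ∑∑-permute (K.reflection p′) (N.reflection u′) (λ q w → a (p -ₖ q) (u -ₙ w) * ā (p′ -ₖ q) (u′ -ₙ w)) ⟩
      sum (λ i → sum (λ s → a (p -ₖ (p′ -ₖ i)) (u -ₙ (u′ -ₙ s)) * ā (p′ -ₖ (p′ -ₖ i)) (u′ -ₙ (u′ -ₙ s))))
        ≈⟨ ∑∑-cong (λ i s → reflexive (≡.cong₂ _*_
             (≡.cong₂ a (K.q-[p-i]≡i+[q-p] p p′ i) (N.q-[p-i]≡i+[q-p] u u′ s))
             (≡.cong₂ ā (K.g-[g-i]≡i p′ i) (N.g-[g-i]≡i u′ s)))) ⟩
      T (toℕ (p -ₖ p′)) (toℕ (u -ₙ u′)) ∎

    Y-normal : ∀ r r′ → ⟨ (Y ᵀ) r , (Y ᵀ) r′ ⟩H ≈ ⟨ Y r′ , Y r ⟩H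
    Y-normal = combine-elim {P = λ r → ∀ r′ → ⟨ (Y ᵀ) r , (Y ᵀ) r′ ⟩H ≈ ⟨ Y r′ , Y r ⟩H} λ p u →
               combine-elim {P = λ r′ → ⟨ (Y ᵀ) (ι p u) , (Y ᵀ) r′ ⟩H ≈ ⟨ Y r′ , Y (ι p u) ⟩H} λ p′ u′ →
               trans (⟨Yᵀ,Yᵀ⟩H p u p′ u′) (sym (⟨Y,Y⟩H p′ u′ p u))

    Y-rowSum : ∀ r → sum (Y r) ≈ S
    Y-rowSum = combine-elim {P = λ r → sum (Y r) ≈ S} λ p u → begin
      sum (Y (ι p u))                              ≈⟨ sum-combine k n (Y (ι p u)) ⟩
      sum (λ q → sum (λ w → Y (ι p u) (ι q w)))    ≈⟨ ∑∑-cong (λ q w → reflexive (Y-ι p u q w)) ⟩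
      sum (λ q → sum (λ w → a (q -ₖ p) (w -ₙ u)))  ≈⟨ ∑∑-permute (K.translation (-ₖ p)) (N.translation (-ₙ u)) a ⟨
      S                                            ∎

    Y-colSum : ∀ l → sum (λ r → Y r l) ≈ S
    Y-colSum = combine-elim {P = λ l → sum (λ r → Y r l) ≈ S} λ p u → begin
      sum (λ r → Y r (ι p u))                      ≈⟨ sum-combine k n (λ r → Y r (ι p u)) ⟩
      sum (λ q → sum (λ w → Y (ι q w) (ι p u)))    ≈⟨ ∑∑-cong (λ q w → reflexive (Y-ι q w p u)) ⟩
      sum (λ q → sum (λ w → a (p -ₖ q) (u -ₙ w)))  ≈⟨ ∑∑-permute (K.reflection p) (N.reflection u) a ⟨
      S                                            ∎

  module BorderedBlockCirculant (k n : ℕ) .{{_ : NonZero k}} .{{_ : NonZero n}}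
      (x₁ x₂ x₃ : Carrier) (a : Fin k → Fin n → Carrier) where
    open BlockCirculant k n a public
    open HalfShifts k n
    open K using (_⊕_; _-ₖ_; -ₖ_; 0ₖ)
    open N using () renaming (_-ₖ_ to _-ₙ_; -ₖ_ to -ₙ_; 0ₖ to 0ₙ)

    X : Mat (ℕ.suc (k ℕ.* n)) (ℕ.suc (k ℕ.* n))
    X = borderMat x₁ x₂ x₃ Y

    γ : Carrier
    γ = x₃ * bar x₃

    r₀ : Fin (k ℕ.* n)
    r₀ = ι 0ₖ 0ₙ

    δ₀ : Fin k → Fin n → Carrier
    δ₀ g h = idMat r₀ (ι g h)

    Conditions : Set ℓ
    Conditions =
        (1# + x₁ * bar x₁ + (k ℕ.* n) ·ℕ (x₂ * bar x₂) ≈ 0#)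
      × (x₁ * bar x₃ + x₂ * sum (λ i → sum (λ s → ā i s)) ≈ 0#)
      × (sum (λ i → Θ (a i) (ā i) 0) ≈ - 1# - x₃ * bar x₃)
      × (∀ t → 1 ≤ t → t ≤ ⌊ n /2⌋ →
           sum (λ i → Θ (a i) (ā i) t) ≈ - (x₃ * bar x₃))
      × (∀ j → 1 ≤ j → j ≤ ⌊ k /2⌋ →
           sum (λ i → Θ (a ((toℕ i ℕ.+ j) mod k)) (ā i) 0) ≈ - (x₃ * bar x₃))
      × (∀ j t → 1 ≤ j → j ≤ k ∸ 1 → 1 ≤ t → t ≤ ⌊ n /2⌋ →
           sum (λ i → Θ (a ((toℕ i ℕ.+ j) mod k)) (ā i) t) ≈ - (x₃ * bar x₃))

    ShiftCondition : Fin k → Fin n → Set ℓ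
    ShiftCondition g h = T (toℕ g) (toℕ h) ≈ - δ₀ g h - γ

    I+Gram-block : ∀ p u p′ u′ →
      I+Gram X (Fin.suc (ι p u)) (Fin.suc (ι p′ u′)) ≈ δ₀ (p′ -ₖ p) (u′ -ₙ u) + (γ + T (toℕ (p′ -ₖ p)) (toℕ (u′ -ₙ u)))
    I+Gram-block p u p′ u′ = +-cong (reflexive (idMat-cong-⇔ to from)) (+-congˡ (⟨Y,Y⟩H p u p′ u′))
      where
      to : ι p u ≡ ι p′ u′ → r₀ ≡ ι (p′ -ₖ p) (u′ -ₙ u)
      to eq with combine-injective p u p′ u′ eq
      ... | ≡.refl , ≡.refl = ≡.sym (≡.cong₂ ι (K.+ₖ-inverseʳ p) (N.+ₖ-inverseʳ u))
      from : r₀ ≡ ι (p′ -ₖ p) (u′ -ₙ u) → ι p u ≡ ι p′ u′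
      from eq with combine-injective 0ₖ 0ₙ (p′ -ₖ p) (u′ -ₙ u) eq
      ... | 0≡p′-p , 0≡u′-u =
        ≡.sym (≡.cong₂ ι (K.x∙y⁻¹≈ε⇒x≈y p′ p (≡.sym 0≡p′-p)) (N.x∙y⁻¹≈ε⇒x≈y u′ u (≡.sym 0≡u′-u)))

    blockGram⇒shift : ∀ p u p′ u′ →
      I+Gram X (Fin.suc (ι p u)) (Fin.suc (ι p′ u′)) ≈ 0# → ShiftCondition (p′ -ₖ p) (u′ -ₙ u)
    blockGram⇒shift p u p′ u′ eq = x+[y+z]≈0⇒z≈-x-y (trans (sym (I+Gram-block p u p′ u′)) eq)

    shift⇒blockGram : ∀ p u p′ u′ →
      ShiftCondition (p′ -ₖ p) (u′ -ₙ u) → I+Gram X (Fin.suc (ι p u)) (Fin.suc (ι p′ u′)) ≈ 0#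
    shift⇒blockGram p u p′ u′ cond = trans (I+Gram-block p u p′ u′) (z≈-x-y⇒x+[y+z]≈0 cond)

    -- The Gram matrix of X is Hermitian, and its entry at (ι g h, r₀) is the one of shift (-g, -h).
    shift-mirror : ∀ g h → ShiftCondition (-ₖ g) (-ₙ h) → ShiftCondition g h
    shift-mirror g h cond = ≡.subst₂ ShiftCondition (K.i-0≡i g) (N.i-0≡i h) (blockGram⇒shift 0ₖ 0ₙ g h r₀-row)
      where
      r₀-column : I+Gram X (Fin.suc (ι g h)) (Fin.suc r₀) ≈ 0#
      r₀-column = shift⇒blockGram g h 0ₖ 0ₙ (≡.subst₂ ShiftCondition (≡.sym (K.+ₖ-identityˡ (-ₖ g))) (≡.sym (N.+ₖ-identityˡ (-ₙ h))) cond)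
      r₀-row : I+Gram X (Fin.suc r₀) (Fin.suc (ι g h)) ≈ 0#
      r₀-row = gram-flip X r₀-column

    δ₀-origin : δ₀ 0ₖ 0ₙ ≡ 1#
    δ₀-origin = idMat-diag r₀

    δ₀-off : ∀ {g h} → 1 ≤ toℕ g ⊎ 1 ≤ toℕ h → δ₀ g h ≡ 0#
    δ₀-off {g} {h} (inj₁ 1≤g) = idMat-off (K.1≤toℕ⇒≢0ₖ 1≤g ∘ proj₁ ∘ combine-injective 0ₖ 0ₙ g h)
    δ₀-off {g} {h} (inj₂ 1≤h) = idMat-off (N.1≤toℕ⇒≢0ₖ 1≤h ∘ proj₂ ∘ combine-injective 0ₖ 0ₙ g h)

    T-0 : ∀ t → T 0 t ≈ sum (λ i → Θ (a i) (ā i) t)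
    T-0 t = sum-cong-≋ (λ i → reflexive (≡.cong (λ i′ → Θ (a i′) (ā i) t) (K.i⊕0≡i i)))

    origin-shift⇔ : ShiftCondition 0ₖ 0ₙ ⇔ (sum (λ i → Θ (a i) (ā i) 0) ≈ - 1# - γ)
    origin-shift⇔ = mk⇔
      (λ cond → trans (sym T₀₀) (trans cond (reflexive (≡.cong (λ d → - d - γ) δ₀-origin))))
      (λ eq → trans T₀₀ (trans eq (reflexive (≡.cong (λ d → - d - γ) (≡.sym δ₀-origin)))))
      where
      T₀₀ : T (toℕ 0ₖ) (toℕ 0ₙ) ≈ sum (λ i → Θ (a i) (ā i) 0)
      T₀₀ = trans (reflexive (≡.cong₂ T K.toℕ-0ₖ N.toℕ-0ₖ)) (T-0 0)

    off-shift⇔ : ∀ {g h} → 1 ≤ toℕ g ⊎ 1 ≤ toℕ h → ShiftCondition g h ⇔ (T (toℕ g) (toℕ h) ≈ - γ)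
    off-shift⇔ {g} {h} off = mk⇔ (λ cond → trans cond -δ₀-γ≈-γ) (λ eq → trans eq (sym -δ₀-γ≈-γ))
      where
      -δ₀-γ≈-γ : - δ₀ g h - γ ≈ - γ
      -δ₀-γ≈-γ = trans (+-congʳ (trans (-‿cong (reflexive (δ₀-off off))) ε⁻¹≈ε)) (+-identityˡ _)

    conditions⇒half-shift : Conditions → ∀ {g h} → HalfShift g h → ShiftCondition g h
    conditions⇒half-shift (_ , _ , c₃ , c₄ , c₅ , c₆) {g} {h} = λ where
      (origin g≡0 h≡0) →
        ≡.subst₂ ShiftCondition (≡.sym (K.toℕ≡0⇒≡0ₖ g≡0)) (≡.sym (N.toℕ≡0⇒≡0ₖ h≡0)) (Equivalence.from origin-shift⇔ c₃)
      (inBlock g≡0 1≤h h≤) → Equivalence.from (off-shift⇔ (inj₂ 1≤h))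
        (trans (reflexive (≡.cong (λ j → T j (toℕ h)) g≡0)) (trans (T-0 (toℕ h)) (c₄ (toℕ h) 1≤h h≤)))
      (acrossBlocks 1≤g g≤ h≡0) → Equivalence.from (off-shift⇔ (inj₁ 1≤g))
        (trans (reflexive (≡.cong (T (toℕ g)) h≡0)) (c₅ (toℕ g) 1≤g g≤))
      (general 1≤g 1≤h h≤) → Equivalence.from (off-shift⇔ (inj₁ 1≤g))
        (c₆ (toℕ g) (toℕ h) 1≤g (ℕₚ.∸-monoˡ-≤ 1 (toℕ<n g)) 1≤h h≤)

    conditions⇒shift : Conditions → ∀ g h → ShiftCondition g h
    conditions⇒shift conds g h =
      [ conditions⇒half-shift conds , shift-mirror g h ∘ conditions⇒half-shift conds ]′ (halfShift⊎mirror g h)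

    shifts⇒T : (∀ g h → ShiftCondition g h) → ∀ {j t} → j < k → t < n → 1 ≤ j ⊎ 1 ≤ t → T j t ≈ - γ
    shifts⇒T cond {j} {t} j<k t<n off =
      ≡.subst₂ (λ j′ t′ → T j′ t′ ≈ - γ) j≡ t≡ (Equivalence.to (off-shift⇔ off′) (cond (j mod k) (t mod n)))
      where
      j≡ : toℕ (j mod k) ≡ j
      j≡ = K.toℕ-mod-< j<k
      t≡ : toℕ (t mod n) ≡ t
      t≡ = N.toℕ-mod-< t<n
      off′ : 1 ≤ toℕ (j mod k) ⊎ 1 ≤ toℕ (t mod n)
      off′ = Sum.map (≡.subst (1 ≤_) (≡.sym j≡)) (≡.subst (1 ≤_) (≡.sym t≡)) off

    border-row-sum : ∀ r → sum (λ l → x₂ * bar (Y r l)) ≈ x₂ * sum (λ i → sum (λ s → ā i s))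
    border-row-sum r = trans (sum-*-bar x₂ (Y r))
      (*-congˡ (trans (bar-cong (Y-rowSum r)) (trans (bar-sum (λ i → sum (a i))) (sum-cong-≋ (λ i → bar-sum (a i))))))

    gram⇒conditions : GramIsMinusId X → Conditions
    gram⇒conditions gram = c₁ , c₂ , c₃ , c₄ , c₅ , c₆
      where
      shift : ∀ g h → ShiftCondition g h
      shift g h = ≡.subst₂ ShiftCondition (K.i-0≡i g) (N.i-0≡i h)
                    (blockGram⇒shift 0ₖ 0ₙ g h (gram (Fin.suc r₀) (Fin.suc (ι g h))))
      c₁ = trans (+-assoc _ _ _) (trans (+-congˡ (+-congˡ (sym (sum-replicate (k ℕ.* n))))) (gram Fin.zero Fin.zero))
      c₂ = trans (+-congˡ (sym (border-row-sum r₀))) (trans (sym (+-identityˡ _)) (gram Fin.zero (Fin.suc r₀)))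
      c₃ = Equivalence.to origin-shift⇔ (shift 0ₖ 0ₙ)
      c₄ = λ t 1≤t t≤ → trans (sym (T-0 t)) (shifts⇒T shift (ℕ.>-nonZero⁻¹ k) (ℕₚ.≤-<-trans t≤ N.⌊m/2⌋<m) (inj₂ 1≤t))
      c₅ = λ j 1≤j j≤ → shifts⇒T shift (ℕₚ.≤-<-trans j≤ K.⌊m/2⌋<m) (ℕ.>-nonZero⁻¹ n) (inj₁ 1≤j)
      c₆ = λ j t 1≤j j≤ 1≤t t≤ → shifts⇒T shift (K.≤m∸1⇒<m j≤) (ℕₚ.≤-<-trans t≤ N.⌊m/2⌋<m) (inj₁ 1≤j)

    conditions⇒gram : Conditions → GramIsMinusId X
    conditions⇒gram conds@(c₁ , c₂ , _) = gram
      where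
      gram₀ : ∀ r → I+Gram X Fin.zero (Fin.suc r) ≈ 0#
      gram₀ r = trans (+-identityˡ _) (trans (+-congˡ (border-row-sum r)) c₂)

      gram : GramIsMinusId X
      gram Fin.zero    Fin.zero    =
        trans (+-congˡ (+-congˡ (sum-replicate (k ℕ.* n)))) (trans (sym (+-assoc _ _ _)) c₁)
      gram Fin.zero    (Fin.suc r) = gram₀ r
      gram (Fin.suc r) Fin.zero    = gram-flip X {Fin.zero} {Fin.suc r} (gram₀ r)
      gram (Fin.suc r) (Fin.suc r′) =
        combine-elim {P = λ r → ∀ r′ → I+Gram X (Fin.suc r) (Fin.suc r′) ≈ 0#} (λ p u →
        combine-elim {P = λ r′ → I+Gram X (Fin.suc (ι p u)) (Fin.suc r′) ≈ 0#} (λ p′ u′ →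
        shift⇒blockGram p u p′ u′ (conditions⇒shift conds (p′ -ₖ p) (u′ -ₙ u)))) r r′

theorem3 : ∀ {c ℓ} (R : CommutativeRing c ℓ) → Over.IsFrobenius R →
  (bar : CommutativeRing.Carrier R → CommutativeRing.Carrier R) →
  Over.IsNontrivialInvolution R bar →
  (k n : ℕ) .{{_ : NonZero k}} .{{_ : NonZero n}} →
  (x₁ x₂ x₃ : CommutativeRing.Carrier R) →
  (a : Fin k → Fin n → CommutativeRing.Carrier R) →
  let open CommutativeRing R
      open Over R
      open WithInvolution bar
      ā : Fin k → Fin n → Carrier
      ā i s = bar (a i s)
  in IsHermitianSelfDual (RowSpan (genMatrix k n x₁ x₂ x₃ a))
     ⇔ ( (1# + x₁ * bar x₁ + (k ℕ.* n) ·ℕ (x₂ * bar x₂) ≈ 0#)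
       × (x₁ * bar x₃ + x₂ * sum (λ i → sum (λ s → ā i s)) ≈ 0#)
       × (sum (λ i → Θ (a i) (ā i) 0) ≈ - 1# - x₃ * bar x₃)
       × (∀ t → 1 ≤ t → t ≤ ⌊ n /2⌋ →
            sum (λ i → Θ (a i) (ā i) t) ≈ - (x₃ * bar x₃))
       × (∀ j → 1 ≤ j → j ≤ ⌊ k /2⌋ →
            sum (λ i → Θ (a ((toℕ i ℕ.+ j) mod k)) (ā i) 0) ≈ - (x₃ * bar x₃))
       × (∀ j t → 1 ≤ j → j ≤ k ∸ 1 → 1 ≤ t → t ≤ ⌊ n /2⌋ →
            sum (λ i → Θ (a ((toℕ i ℕ.+ j) mod k)) (ā i) t) ≈ - (x₃ * bar x₃)) )
theorem3 R _ bar inv k n x₁ x₂ x₃ a = mk⇔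
  (gram⇒conditions ∘ selfDual⇒gram X)
  (λ conds → let gram = conditions⇒gram conds in
    grams⇒selfDual X gram (bordered-gramᵀ r₀ x₁ x₂ x₃ S Y Y-rowSum Y-colSum Y-normal gram))
  where
  open Involutive R bar inv
  open BorderedBlockCirculant k n x₁ x₂ x₃ a
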